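{- Let $n\ge 0$ and let $Z^{\nearrow}_n$ be the number of up-from-zero situations of a random lattice path $W_n$ of length $n$ (as described in the context). Then $\mathbb{E}[Z^{\nearrow}_n]=\frac12 H^{\mathrm{odd}}_n$, where $H^{\mathrm{odd}}_m=\sum_{j=1}^m\frac{[j\text{ odd}]}{j}$.
   Context: Random lattice path model: a path $W_n$ of length $n$ starts at $(0,0)$ and uses steps $(1,+1)$ and $(1,-1)$. First an endpoint $(n,D)$ is chosen with $D$ uniformly distributed on $\{ -n,-n+2,\dots,n-2,n\}$; then a path is chosen uniformly at random among all paths from $(0,0)$ to $(n,D)$. An up-from-zero situation is a point $(t,0)$ of the path such that $(t+1,1)$ is also on the path. $[P]=1$ if $P$ is true and $0$ otherwise. -}

module Defs where

open import Data.Bool using (Bool; true; false; if_then_else_)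
open import Data.Nat as ℕ using (ℕ; zero; suc; _%_; _≡ᵇ_)
open import Data.Integer as ℤ using (ℤ; +_; _-_; _≟_)
open import Data.Rational as ℚ using (ℚ; _/_; _+_; _*_)
open import Data.List using (List; []; _∷_; map; _++_; filter; length; upTo; foldr)
open import Relation.Unary using (Decidable)

-- A lattice path of length n: a list of n steps, true = (1,+1), false = (1,-1).
allPaths : ℕ → List (List Bool)
allPaths zero = [] ∷ []
allPaths (suc n) = map (true ∷_) (allPaths n) ++ map (false ∷_) (allPaths n)

endHeight : List Bool → ℤ
endHeight [] = + 0
endHeight (true ∷ s) = endHeight s ℤ.+ + 1
endHeight (false ∷ s) = endHeight s ℤ.- + 1

upFromZeroFrom : ℤ → List Bool → ℕ
upFromZeroFrom h [] = 0
upFromZeroFrom h (true ∷ s) =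
  (if ℤ.∣ h ∣ ≡ᵇ 0 then 1 else 0) ℕ.+ upFromZeroFrom (h ℤ.+ + 1) s
upFromZeroFrom h (false ∷ s) = upFromZeroFrom (h ℤ.- + 1) s

upFromZero : List Bool → ℕ
upFromZero = upFromZeroFrom (+ 0)

-- uniform average of a finite list of rationals (0 for the empty list,
-- which never occurs below)
sumℚ : List ℚ → ℚ
sumℚ = foldr _+_ ℚ.0ℚ

avg : List ℚ → ℚ
avg [] = ℚ.0ℚ
avg (x ∷ xs) = sumℚ (x ∷ xs) * ((+ 1) / suc (length xs))

endpoint : ℕ → ℕ → ℤ
endpoint n k = + (2 ℕ.* k) - + n

pathsTo : (n : ℕ) → ℤ → List (List Bool)
pathsTo n D = filter (λ p → endHeight p ≟ D) (allPaths n)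

-- E[Z_n^↗]: D uniform on {-n,-n+2,…,n}, then a uniform path to (n,D)
expectedUpFromZero : ℕ → ℚ
expectedUpFromZero n =
  avg (map (λ k → avg (map (λ p → (+ upFromZero p) / 1) (pathsTo n (endpoint n k))))
           (upTo (suc n)))

Hodd : ℕ → ℚ
Hodd zero = ℚ.0ℚ
Hodd (suc m) = Hodd m + (if (suc m % 2) ≡ᵇ 1 then (+ 1) / suc m else ℚ.0ℚ)

-- If the endpoint (n, 2k − n) is chosen uniformly and then one of the C(n, k) paths to it,
-- a path p with k up steps has probability k! (n − k)! / (n + 1)! = weight p / (n + 1)!.
-- Hence E[Z_n] = W_n / (n + 1)! with W_n = Σ_p weight p · Z(p). Appending an up step to p
-- multiplies its weight by (ups p + 1) and adds an up-from-zero situation exactly when p ends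
-- at height 0; appending a down step multiplies it by (downs p + 1). So
-- W_{n+1} = (n + 2) W_n + R_n with R_n = Σ_{p ends at 0} (ups p + 1) weight p, which is
-- (m + 1) (2m)! for n = 2m and 0 for odd n, because the total weight of the paths with
-- k up steps is n!. Thus E[Z_{n+1}] − E[Z_n] = R_n / (n + 2)! is 1 / (2(n + 1)) for even n
-- and 0 for odd n.

module Submission where

open import Defs
open import Algebra.Bundles using (AbelianGroup)
open import Data.Bool using (Bool; true; false; if_then_else_)
open import Data.Integer as ℤ using (ℤ; +_; -[1+_]; _⊖_)
import Data.Integer.Properties as ℤP
open import Data.List using (List; []; _∷_; [_]; _++_; map; filter; length; upTo)
import Data.List.Properties as ListP
open import Data.List.Relation.Unary.All as All using (All; []; _∷_)
import Data.List.Relation.Unary.All.Properties as AllP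
open import Data.Nat as ℕ using (ℕ; zero; suc; _+_; _*_; _∸_; _!; _%_; _≡ᵇ_; _≤_; _<_; z≤n; s≤s; NonZero)
open import Data.Nat.DivMod using ([m+kn]%n≡m%n)
import Data.Nat.Properties as ℕP
open import Data.Nat.Tactic.RingSolver using (solve-∀)
open import Data.Product using (_×_; _,_)
open import Data.Rational as ℚ using (ℚ; _/_; 0ℚ; toℚᵘ)
import Data.Rational.Properties as ℚP
import Data.Rational.Unnormalised as ℚᵘ
import Data.Rational.Unnormalised.Properties as ℚᵘP
open import Data.Sum using (_⊎_; inj₁; inj₂)
open import Function.Bundles using (_⇔_; mk⇔)
open import Relation.Binary.PropositionalEquality hiding ([_])
open import Relation.Nullary using (Dec; does; _because_; ¬_; invert)
open import Relation.Nullary.Decidable using (dec-true; dec-false; does-⇔)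

open import Algebra.Properties.CommutativeSemigroup ℤP.+-commutativeSemigroup using (xy∙z≈x∙zy)
open import Algebra.Properties.CommutativeSemigroup ℕP.*-commutativeSemigroup using (x∙yz≈y∙xz)
open import Algebra.Properties.Group (AbelianGroup.group ℤP.+-0-abelianGroup) using (∙-cancelʳ)

private
  variable
    A B : Set

∑ : List A → (A → ℕ) → ℕ
∑ []       f = 0
∑ (x ∷ xs) f = f x + ∑ xs f

∑-++ : ∀ (xs ys : List A) f → ∑ (xs ++ ys) f ≡ ∑ xs f + ∑ ys f
∑-++ []       ys f = refl
∑-++ (x ∷ xs) ys f = trans (cong (_+_ (f x)) (∑-++ xs ys f)) (sym (ℕP.+-assoc (f x) _ _))

∑-map : ∀ (g : A → B) xs f → ∑ (map g xs) f ≡ ∑ xs (λ x → f (g x))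
∑-map g []       f = refl
∑-map g (x ∷ xs) f = cong (_+_ (f (g x))) (∑-map g xs f)

∑-cong : ∀ {xs : List A} {f g} → All (λ x → f x ≡ g x) xs → ∑ xs f ≡ ∑ xs g
∑-cong []            = refl
∑-cong (fx≡gx ∷ eqs) = cong₂ _+_ fx≡gx (∑-cong eqs)

∑-zero : ∀ (xs : List A) → ∑ xs (λ _ → 0) ≡ 0
∑-zero []       = refl
∑-zero (x ∷ xs) = ∑-zero xs

∑-+ : ∀ (xs : List A) f g → ∑ xs (λ x → f x + g x) ≡ ∑ xs f + ∑ xs g
∑-+ []       f g = refl
∑-+ (x ∷ xs) f g = trans (cong (_+_ (f x + g x)) (∑-+ xs f g)) (interchange (f x) (g x) _ _)
  where
  interchange : ∀ a b c d → a + b + (c + d) ≡ a + c + (b + d)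
  interchange = solve-∀

∑-*ˡ : ∀ (xs : List A) c f → ∑ xs (λ x → c * f x) ≡ c * ∑ xs f
∑-*ˡ []       c f = sym (ℕP.*-zeroʳ c)
∑-*ˡ (x ∷ xs) c f = trans (cong (_+_ (c * f x)) (∑-*ˡ xs c f)) (sym (ℕP.*-distribˡ-+ c (f x) _))

∑-const : ∀ (xs : List A) c → ∑ xs (λ _ → c) ≡ length xs * c
∑-const []       c = refl
∑-const (x ∷ xs) c = cong (_+_ c) (∑-const xs c)

when : {P : Set} → Dec P → ℕ → ℕ
when P? x = if does P? then x else 0

when-yes : ∀ {P : Set} (P? : Dec P) {x} → P → when P? x ≡ x
when-yes P? p rewrite dec-true P? p = refl

when-no : ∀ {P : Set} (P? : Dec P) {x} → ¬ P → when P? x ≡ 0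
when-no P? ¬p rewrite dec-false P? ¬p = refl

when-* : ∀ {P : Set} (P? : Dec P) {x y} c → (P → x ≡ c * y) → when P? x ≡ c * when P? y
when-* (true  because [p]) c x≡cy = x≡cy (invert [p])
when-* (false because _)   c x≡cy = sym (ℕP.*-zeroʳ c)

when-cong : ∀ {P Q : Set} (P? : Dec P) (Q? : Dec Q) {x} → P ⇔ Q → when P? x ≡ when Q? x
when-cong P? Q? {x} P⇔Q = cong (λ b → if b then x else 0) (does-⇔ P⇔Q P? Q?)

filter-cong-local : ∀ {P Q : A → Set} (P? : ∀ x → Dec (P x)) (Q? : ∀ x → Dec (Q x)) {xs} →
                    All (λ x → P x ⇔ Q x) xs → filter P? xs ≡ filter Q? xs
filter-cong-local P? Q? []                       = refl
filter-cong-local P? Q? {x ∷ _} (Px⇔Qx ∷ P⇔Q)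
  with does (P? x) | does (Q? x) | does-⇔ Px⇔Qx (P? x) (Q? x)
... | true  | .true  | refl = cong (x ∷_) (filter-cong-local P? Q? P⇔Q)
... | false | .false | refl = filter-cong-local P? Q? P⇔Q

∑-filter : ∀ {P : A → Set} (P? : ∀ x → Dec (P x)) xs f →
           ∑ (filter P? xs) f ≡ ∑ xs (λ x → when (P? x) (f x))
∑-filter P? []       f = refl
∑-filter P? (x ∷ xs) f with does (P? x)
... | true  = cong (_+_ (f x)) (∑-filter P? xs f)
... | false = ∑-filter P? xs f

∑-swap : ∀ (xs : List A) (ys : List B) (f : A → B → ℕ) →
         ∑ xs (λ x → ∑ ys (f x)) ≡ ∑ ys (λ y → ∑ xs (λ x → f x y))
∑-swap []       ys f = sym (∑-zero ys)
∑-swap (x ∷ xs) ys f = trans (cong (_+_ (∑ ys (f x))) (∑-swap xs ys f)) (sym (∑-+ ys (f x) _))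

∑-upTo-indicator : ∀ m u c → u < m → ∑ (upTo m) (λ k → when (u ℕ.≟ k) c) ≡ c
∑-upTo-indicator (suc m) u c (s≤s u≤m) = begin
  ∑ (upTo (suc m)) [u≡_]          ≡⟨ cong (λ ks → ∑ ks [u≡_]) (ListP.upTo-∷ʳ m) ⟨
  ∑ (upTo m ++ [ m ]) [u≡_]       ≡⟨ ∑-++ (upTo m) [ m ] [u≡_] ⟩
  ∑ (upTo m) [u≡_] + ([u≡ m ] + 0) ≡⟨ split (ℕP.m≤n⇒m<n∨m≡n u≤m) ⟩
  c                                ∎
  where
  open ≡-Reasoning
  [u≡_] : ℕ → ℕ
  [u≡ k ] = when (u ℕ.≟ k) c
  split : u < m ⊎ u ≡ m → ∑ (upTo m) [u≡_] + ([u≡ m ] + 0) ≡ c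
  split (inj₁ u<m) rewrite ∑-upTo-indicator m u c u<m | when-no (u ℕ.≟ m) {c} (ℕP.<⇒≢ u<m) =
    ℕP.+-identityʳ c
  split (inj₂ refl) rewrite when-yes (u ℕ.≟ u) {c} refl = trans (cong (_+ (c + 0)) below-u) (ℕP.+-identityʳ c)
    where
    below-u : ∑ (upTo u) [u≡_] ≡ 0
    below-u = trans (∑-cong (All.map (λ k<u → when-no (u ℕ.≟ _) (ℕP.>⇒≢ k<u)) (AllP.all-upTo u)))
                    (∑-zero (upTo u))

∑-partition : ∀ m (key : A → ℕ) xs f → All (λ x → key x < m) xs →
              ∑ xs f ≡ ∑ (upTo m) (λ k → ∑ (filter (λ x → key x ℕ.≟ k) xs) f)
∑-partition m key xs f keys<m = begin
  ∑ xs f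
    ≡⟨ ∑-cong (All.map (λ {x} key<m → sym (∑-upTo-indicator m (key x) (f x) key<m)) keys<m) ⟩
  ∑ xs (λ x → ∑ (upTo m) (λ k → when (key x ℕ.≟ k) (f x)))
    ≡⟨ ∑-swap xs (upTo m) _ ⟩
  ∑ (upTo m) (λ k → ∑ xs (λ x → when (key x ℕ.≟ k) (f x)))
    ≡⟨ ∑-cong (All.universal (λ k → sym (∑-filter (λ x → key x ℕ.≟ k) xs f)) (upTo m)) ⟩
  ∑ (upTo m) (λ k → ∑ (filter (λ x → key x ℕ.≟ k) xs) f) ∎
  where open ≡-Reasoning

toℚᵘ-/ : ∀ a b .{{_ : NonZero b}} → toℚᵘ (+ a / b) ℚᵘ.≃ (+ a ℚᵘ./ b)
toℚᵘ-/ a (suc b) = ℚP.toℚᵘ-fromℚᵘ (ℚᵘ.mkℚᵘ (+ a) b)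

/-cross : ∀ a b c d .{{_ : NonZero b}} .{{_ : NonZero d}} → a * d ≡ c * b → + a / b ≡ + c / d
/-cross a b@(suc _) c d@(suc _) ad≡cb = ℚP.toℚᵘ-injective (begin
  toℚᵘ (+ a / b) ≈⟨ toℚᵘ-/ a b ⟩
  + a ℚᵘ./ b     ≈⟨ ℚᵘ.*≡* (trans (sym (ℤP.pos-* a d)) (trans (cong +_ ad≡cb) (ℤP.pos-* c b))) ⟩
  + c ℚᵘ./ d     ≈⟨ toℚᵘ-/ c d ⟨
  toℚᵘ (+ c / d) ∎)
  where open ℚᵘP.≃-Reasoning

/-+-/ : ∀ a b c d .{{_ : NonZero b}} .{{_ : NonZero d}} →
        + a / b ℚ.+ + c / d ≡ (+ (a * d + c * b) / (b * d)) {{ℕP.m*n≢0 b d}}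
/-+-/ a b@(suc _) c d@(suc _) = ℚP.toℚᵘ-injective (begin
  toℚᵘ (+ a / b ℚ.+ + c / d)             ≈⟨ ℚP.toℚᵘ-homo-+ (+ a / b) (+ c / d) ⟩
  toℚᵘ (+ a / b) ℚᵘ.+ toℚᵘ (+ c / d)     ≈⟨ ℚᵘP.+-cong (toℚᵘ-/ a b) (toℚᵘ-/ c d) ⟩
  + a ℚᵘ./ b ℚᵘ.+ + c ℚᵘ./ d             ≡⟨ cong (ℚᵘ._/ (b * d)) numerator ⟨
  + (a * d + c * b) ℚᵘ./ (b * d)         ≈⟨ toℚᵘ-/ (a * d + c * b) (b * d) ⟨
  toℚᵘ (+ (a * d + c * b) / (b * d))     ∎)
  where
  open ℚᵘP.≃-Reasoning
  numerator : + (a * d + c * b) ≡ + a ℤ.* + d ℤ.+ + c ℤ.* + b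
  numerator = trans (ℤP.pos-+ (a * d) (c * b)) (cong₂ ℤ._+_ (ℤP.pos-* a d) (ℤP.pos-* c b))

/-*-/ : ∀ a b c d .{{_ : NonZero b}} .{{_ : NonZero d}} →
        (+ a / b) ℚ.* (+ c / d) ≡ (+ (a * c) / (b * d)) {{ℕP.m*n≢0 b d}}
/-*-/ a b@(suc _) c d@(suc _) = ℚP.toℚᵘ-injective (begin
  toℚᵘ ((+ a / b) ℚ.* (+ c / d))         ≈⟨ ℚP.toℚᵘ-homo-* (+ a / b) (+ c / d) ⟩
  toℚᵘ (+ a / b) ℚᵘ.* toℚᵘ (+ c / d)     ≈⟨ ℚᵘP.*-cong (toℚᵘ-/ a b) (toℚᵘ-/ c d) ⟩
  (+ a ℚᵘ./ b) ℚᵘ.* (+ c ℚᵘ./ d)         ≡⟨ cong (ℚᵘ._/ (b * d)) (ℤP.pos-* a c) ⟨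
  + (a * c) ℚᵘ./ (b * d)                 ≈⟨ toℚᵘ-/ (a * c) (b * d) ⟨
  toℚᵘ (+ (a * c) / (b * d))             ∎)
  where open ℚᵘP.≃-Reasoning

/-distribʳ-+ : ∀ a b d .{{_ : NonZero d}} → + (a + b) / d ≡ + a / d ℚ.+ + b / d
/-distribʳ-+ a b d = begin
  + (a + b) / d                   ≡⟨ /-cross (a + b) d (a * d + b * d) (d * d) (regroup a b d) ⟩
  + (a * d + b * d) / (d * d)     ≡⟨ /-+-/ a d b d ⟨
  + a / d ℚ.+ + b / d             ∎
  where
  open ≡-Reasoning
  instance
    d*d≢0 : NonZero (d * d)
    d*d≢0 = ℕP.m*n≢0 d d
  regroup : ∀ a b d → (a + b) * (d * d) ≡ (a * d + b * d) * d
  regroup = solve-∀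

sumℚ-/ : ∀ (xs : List A) g d .{{_ : NonZero d}} → sumℚ (map (λ x → + g x / d) xs) ≡ + ∑ xs g / d
sumℚ-/ []       g d = sym (ℚP.0/n≡0 d)
sumℚ-/ (x ∷ xs) g d = trans (cong (+ g x / d ℚ.+_) (sumℚ-/ xs g d)) (sym (/-distribʳ-+ (g x) (∑ xs g) d))

avg-/ : ∀ (xs : List A) g d .{{_ : NonZero d}} .{{_ : NonZero (length xs)}} →
        avg (map (λ x → + g x / d) xs) ≡ (+ ∑ xs g / (d * length xs)) {{ℕP.m*n≢0 d (length xs)}}
avg-/ {A} (x ∷ xs) g d = begin
  sumℚ (map h (x ∷ xs)) ℚ.* (+ 1 / suc (length (map h xs)))
    ≡⟨ cong (λ l → sumℚ (map h (x ∷ xs)) ℚ.* (+ 1 / suc l)) (ListP.length-map h xs) ⟩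
  sumℚ (map h (x ∷ xs)) ℚ.* (+ 1 / suc (length xs))
    ≡⟨ cong (ℚ._* (+ 1 / suc (length xs))) (sumℚ-/ (x ∷ xs) g d) ⟩
  (+ ∑ (x ∷ xs) g / d) ℚ.* (+ 1 / suc (length xs))
    ≡⟨ /-*-/ (∑ (x ∷ xs) g) d 1 (suc (length xs)) ⟩
  + (∑ (x ∷ xs) g * 1) / (d * suc (length xs))
    ≡⟨ ℚP./-cong (cong +_ (ℕP.*-identityʳ (∑ (x ∷ xs) g))) refl ⟩
  + ∑ (x ∷ xs) g / (d * suc (length xs)) ∎
  where
  open ≡-Reasoning
  h : A → ℚ
  h x = + g x / d
  instance
    d*[1+∣xs∣]≢0 : NonZero (d * suc (length xs))
    d*[1+∣xs∣]≢0 = ℕP.m*n≢0 d (suc (length xs))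

ups downs : List Bool → ℕ
ups []          = 0
ups (true ∷ p)  = suc (ups p)
ups (false ∷ p) = ups p
downs []          = 0
downs (true ∷ p)  = downs p
downs (false ∷ p) = suc (downs p)

weight : List Bool → ℕ
weight p = ups p ! * downs p !

weight-true∷ : ∀ p → weight (true ∷ p) ≡ suc (ups p) * weight p
weight-true∷ p = ℕP.*-assoc (suc (ups p)) (ups p !) (downs p !)

weight-false∷ : ∀ p → weight (false ∷ p) ≡ suc (downs p) * weight p
weight-false∷ p = x∙yz≈y∙xz (ups p !) (suc (downs p)) (downs p !)

ups-++ : ∀ p q → ups (p ++ q) ≡ ups p + ups q
ups-++ []          q = refl
ups-++ (true ∷ p)  q = cong suc (ups-++ p q)
ups-++ (false ∷ p) q = ups-++ p q

downs-++ : ∀ p q → downs (p ++ q) ≡ downs p + downs q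
downs-++ []          q = refl
downs-++ (true ∷ p)  q = downs-++ p q
downs-++ (false ∷ p) q = cong suc (downs-++ p q)

weight-∷ʳ-true : ∀ p → weight (p ++ [ true ]) ≡ suc (ups p) * weight p
weight-∷ʳ-true p rewrite ups-++ p [ true ] | downs-++ p [ true ]
                       | ℕP.+-comm (ups p) 1 | ℕP.+-identityʳ (downs p) = weight-true∷ p

weight-∷ʳ-false : ∀ p → weight (p ++ [ false ]) ≡ suc (downs p) * weight p
weight-∷ʳ-false p rewrite ups-++ p [ false ] | downs-++ p [ false ]
                        | ℕP.+-comm (downs p) 1 | ℕP.+-identityʳ (ups p) = weight-false∷ p

allPaths-length : ∀ n → All (λ p → ups p + downs p ≡ n) (allPaths n)
allPaths-length zero    = refl ∷ []
allPaths-length (suc n) = AllP.++⁺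
  (AllP.map⁺ (All.map (cong suc) (allPaths-length n)))
  (AllP.map⁺ (All.map (λ {p} len → trans (ℕP.+-suc (ups p) (downs p)) (cong suc len)) (allPaths-length n)))

∑-allPaths-cong : ∀ n {f g} → (∀ p → ups p + downs p ≡ n → f p ≡ g p) →
                  ∑ (allPaths n) f ≡ ∑ (allPaths n) g
∑-allPaths-cong n f≡g = ∑-cong (All.map (f≡g _) (allPaths-length n))

∑-allPaths-suc : ∀ n f →
  ∑ (allPaths (suc n)) f ≡ ∑ (allPaths n) (λ p → f (true ∷ p)) + ∑ (allPaths n) (λ p → f (false ∷ p))
∑-allPaths-suc n f = trans (∑-++ (map (true ∷_) (allPaths n)) _ f)
  (cong₂ _+_ (∑-map (true ∷_) (allPaths n) f) (∑-map (false ∷_) (allPaths n) f))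

∑-allPaths-snoc : ∀ n f → ∑ (allPaths (suc n)) f ≡ ∑ (allPaths n) (λ p → f (p ++ [ true ]) + f (p ++ [ false ]))
∑-allPaths-snoc zero    f = sym (ℕP.+-assoc (f [ true ]) (f [ false ]) 0)
∑-allPaths-snoc (suc n) f = begin
  ∑ (allPaths (suc (suc n))) f
    ≡⟨ ∑-allPaths-suc (suc n) f ⟩
  ∑ (allPaths (suc n)) (λ p → f (true ∷ p)) + ∑ (allPaths (suc n)) (λ p → f (false ∷ p))
    ≡⟨ cong₂ _+_ (∑-allPaths-snoc n (λ p → f (true ∷ p))) (∑-allPaths-snoc n (λ p → f (false ∷ p))) ⟩
  ∑ (allPaths n) (λ p → f ((true ∷ p) ++ [ true ]) + f ((true ∷ p) ++ [ false ]))
    + ∑ (allPaths n) (λ p → f ((false ∷ p) ++ [ true ]) + f ((false ∷ p) ++ [ false ]))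
    ≡⟨ ∑-allPaths-suc n (λ p → f (p ++ [ true ]) + f (p ++ [ false ])) ⟨
  ∑ (allPaths (suc n)) (λ p → f (p ++ [ true ]) + f (p ++ [ false ])) ∎
  where open ≡-Reasoning

endHeight-⊖ : ∀ p → endHeight p ≡ ups p ⊖ downs p
endHeight-⊖ []          = refl
endHeight-⊖ (true ∷ p)  = trans (cong (ℤ._+ + 1) (endHeight-⊖ p))
  (trans (ℤP.distribˡ-⊖-+-pos 1 (ups p) (downs p)) (cong (_⊖ downs p) (ℕP.+-comm (ups p) 1)))
endHeight-⊖ (false ∷ p) = trans (cong (ℤ._+ -[1+ 0 ]) (endHeight-⊖ p))
  (trans (ℤP.distribˡ-⊖-+-neg 0 (ups p) (downs p)) (cong (ups p ⊖_) (ℕP.+-identityʳ (suc (downs p)))))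

endpoint-⊖ : ∀ n k → endpoint n k ≡ 2 * k ⊖ n
endpoint-⊖ n k = ℤP.[+m]-[+n]≡m⊖n (2 * k) n

endHeight-endpoint : ∀ p → endHeight p ≡ endpoint (ups p + downs p) (ups p)
endHeight-endpoint p = begin
  endHeight p                      ≡⟨ endHeight-⊖ p ⟩
  u ⊖ d                            ≡⟨ cong (_⊖ d) (ℕP.+-identityʳ u) ⟨
  (u + 0) ⊖ d                      ≡⟨ ℤP.+-cancelˡ-⊖ u (u + 0) d ⟨
  2 * u ⊖ (u + d)                  ≡⟨ endpoint-⊖ (u + d) u ⟨
  endpoint (u + d) u               ∎
  where
  open ≡-Reasoning
  u d : ℕ
  u = ups p
  d = downs p

endpoint-injective : ∀ n {k l} → endpoint n k ≡ endpoint n l → k ≡ l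
endpoint-injective n {k} {l} eq =
  ℕP.*-cancelˡ-≡ k l 2 (ℤP.+-injective (∙-cancelʳ (ℤ.- + n) (+ (2 * k)) (+ (2 * l)) eq))

endHeight≡endpoint⇔ups≡ : ∀ {n} k p → ups p + downs p ≡ n → (endHeight p ≡ endpoint n k) ⇔ (ups p ≡ k)
endHeight≡endpoint⇔ups≡ k p refl = mk⇔
  (λ eq → endpoint-injective (ups p + downs p) (trans (sym (endHeight-endpoint p)) eq))
  (λ { refl → endHeight-endpoint p })

pathsWithUps : ℕ → ℕ → List (List Bool)
pathsWithUps n k = filter (λ p → ups p ℕ.≟ k) (allPaths n)

pathsTo-endpoint : ∀ n k → pathsTo n (endpoint n k) ≡ pathsWithUps n k
pathsTo-endpoint n k = filter-cong-local (λ p → endHeight p ℤ.≟ endpoint n k) (λ p → ups p ℕ.≟ k)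
  (All.map (λ {p} → endHeight≡endpoint⇔ups≡ k p) (allPaths-length n))

∑-pathsWithUps : ∀ n k f → ∑ (pathsWithUps n k) f ≡ ∑ (allPaths n) (λ p → when (ups p ℕ.≟ k) (f p))
∑-pathsWithUps n k = ∑-filter (λ p → ups p ℕ.≟ k) (allPaths n)

∑-pathsWithUps-suc : ∀ n k f → ∑ (pathsWithUps (suc n) k) f ≡
  ∑ (allPaths n) (λ p → when (suc (ups p) ℕ.≟ k) (f (true ∷ p)))
    + ∑ (allPaths n) (λ p → when (ups p ℕ.≟ k) (f (false ∷ p)))
∑-pathsWithUps-suc n k f = trans (∑-pathsWithUps (suc n) k f) (∑-allPaths-suc n _)

∑-pathsWithUps-scale : ∀ n k c {f : List Bool → ℕ} →
  (∀ p → ups p + downs p ≡ n → ups p ≡ k → f p ≡ c * weight p) →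
  ∑ (allPaths n) (λ p → when (ups p ℕ.≟ k) (f p)) ≡ c * ∑ (pathsWithUps n k) weight
∑-pathsWithUps-scale n k c {f} f≡cw = begin
  ∑ (allPaths n) (λ p → when (ups p ℕ.≟ k) (f p))
    ≡⟨ ∑-allPaths-cong n (λ p len → when-* (ups p ℕ.≟ k) c (f≡cw p len)) ⟩
  ∑ (allPaths n) (λ p → c * when (ups p ℕ.≟ k) (weight p))
    ≡⟨ ∑-*ˡ (allPaths n) c _ ⟩
  c * ∑ (allPaths n) (λ p → when (ups p ℕ.≟ k) (weight p))
    ≡⟨ cong (c *_) (∑-pathsWithUps n k weight) ⟨
  c * ∑ (pathsWithUps n k) weight ∎
  where open ≡-Reasoning

totalWeight : ℕ → ℕ → ℕ
totalWeight n k = ∑ (pathsWithUps n k) weight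

totalWeight-suc-zero : ∀ n → totalWeight (suc n) 0 ≡ suc n * totalWeight n 0
totalWeight-suc-zero n = begin
  totalWeight (suc n) 0
    ≡⟨ ∑-pathsWithUps-suc n 0 weight ⟩
  ∑ (allPaths n) (λ _ → 0) + ∑ (allPaths n) (λ p → when (ups p ℕ.≟ 0) (weight (false ∷ p)))
    ≡⟨ cong₂ _+_ (∑-zero (allPaths n)) (∑-pathsWithUps-scale n 0 (suc n) λ p len u≡0 →
        trans (weight-false∷ p) (cong (λ d → suc d * weight p) (trans (cong (_+ downs p) (sym u≡0)) len))) ⟩
  suc n * totalWeight n 0 ∎
  where open ≡-Reasoning

totalWeight-suc-suc : ∀ n k →
  totalWeight (suc n) (suc k) ≡ suc k * totalWeight n k + (n ∸ k) * totalWeight n (suc k)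
totalWeight-suc-suc n k = trans (∑-pathsWithUps-suc n (suc k) weight) (cong₂ _+_
  (∑-pathsWithUps-scale n k (suc k) λ p _ u≡k →
    trans (weight-true∷ p) (cong (λ u → suc u * weight p) u≡k))
  (∑-pathsWithUps-scale n (suc k) (n ∸ k) λ p len u≡1+k →
    trans (weight-false∷ p) (cong (_* weight p) (remaining-downs len u≡1+k))))
  where
  remaining-downs : ∀ {u d} → u + d ≡ n → u ≡ suc k → suc d ≡ n ∸ k
  remaining-downs {d = d} refl refl = trans (sym (ℕP.m+n∸m≡n k (suc d))) (cong (_∸ k) (ℕP.+-suc k d))

totalWeight≡! : ∀ {n k} → k ≤ n → totalWeight n k ≡ n !
totalWeight≡! {zero}  {zero}  _ = refl
totalWeight≡! {suc n} {zero}  _ = trans (totalWeight-suc-zero n) (cong (suc n *_) (totalWeight≡! {n} z≤n))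
totalWeight≡! {suc n} {suc k} (s≤s k≤n) = begin
  totalWeight (suc n) (suc k)                                ≡⟨ totalWeight-suc-suc n k ⟩
  suc k * totalWeight n k + (n ∸ k) * totalWeight n (suc k)  ≡⟨ cong₂ _+_ lower upper ⟩
  suc k * n ! + (n ∸ k) * n !                                ≡⟨ ℕP.*-distribʳ-+ (n !) (suc k) (n ∸ k) ⟨
  (suc k + (n ∸ k)) * n !                                    ≡⟨ cong (λ m → suc m * n !) (ℕP.m+[n∸m]≡n k≤n) ⟩
  suc n !                                                    ∎
  where
  open ≡-Reasoning
  lower : suc k * totalWeight n k ≡ suc k * n !
  lower = cong (suc k *_) (totalWeight≡! k≤n)
  upper : (n ∸ k) * totalWeight n (suc k) ≡ (n ∸ k) * n !
  upper with ℕP.m≤n⇒m<n∨m≡n k≤n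
  ... | inj₁ k<n  = cong ((n ∸ k) *_) (totalWeight≡! k<n)
  ... | inj₂ refl rewrite ℕP.n∸n≡0 n = refl

weight-pathsWithUps : ∀ n k → All (λ p → weight p ≡ k ! * (n ∸ k) !) (pathsWithUps n k)
weight-pathsWithUps n k = All.zipWith (λ {p} → weight≡ {p})
  (AllP.all-filter (λ p → ups p ℕ.≟ k) (allPaths n) , AllP.filter⁺ (λ p → ups p ℕ.≟ k) (allPaths-length n))
  where
  weight≡ : ∀ {p} → ups p ≡ k × ups p + downs p ≡ n → weight p ≡ k ! * (n ∸ k) !
  weight≡ {p} (u≡k , len) = cong₂ (λ u d → u ! * d !) u≡k
    (trans (sym (ℕP.m+n∸m≡n (ups p) (downs p))) (cong₂ _∸_ len u≡k))

∑-weight*-pathsWithUps : ∀ n k g →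
  ∑ (pathsWithUps n k) (λ p → weight p * g p) ≡ k ! * (n ∸ k) ! * ∑ (pathsWithUps n k) g
∑-weight*-pathsWithUps n k g = trans (∑-cong (All.map (λ {p} → cong (_* g p)) (weight-pathsWithUps n k)))
  (∑-*ˡ (pathsWithUps n k) (k ! * (n ∸ k) !) g)

length-pathsWithUps : ∀ {n k} → k ≤ n → length (pathsWithUps n k) * (k ! * (n ∸ k) !) ≡ n !
length-pathsWithUps {n} {k} k≤n = begin
  length (pathsWithUps n k) * (k ! * (n ∸ k) !)  ≡⟨ ∑-const (pathsWithUps n k) _ ⟨
  ∑ (pathsWithUps n k) (λ _ → k ! * (n ∸ k) !)   ≡⟨ ∑-cong (weight-pathsWithUps n k) ⟨
  totalWeight n k                                ≡⟨ totalWeight≡! k≤n ⟩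
  n !                                            ∎
  where open ≡-Reasoning

avg-upFromZero-pathsTo : ∀ {n k} → k ≤ n → avg (map (λ p → + upFromZero p / 1) (pathsTo n (endpoint n k))) ≡
                         (+ ∑ (pathsWithUps n k) (λ p → weight p * upFromZero p) / n !) {{n ℕP.!≢0}}
avg-upFromZero-pathsTo {n} {k} k≤n = begin
  avg (map (λ p → + upFromZero p / 1) (pathsTo n (endpoint n k)))
    ≡⟨ cong (λ ps → avg (map (λ p → + upFromZero p / 1) ps)) (pathsTo-endpoint n k) ⟩
  avg (map (λ p → + upFromZero p / 1) (pathsWithUps n k))
    ≡⟨ avg-/ (pathsWithUps n k) upFromZero 1 ⟩
  + S / (1 * c)
    ≡⟨ /-cross S (1 * c) (cf * S) (n !) cross ⟩
  + (cf * S) / (n !)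
    ≡⟨ cong (λ s → + s / (n !)) (∑-weight*-pathsWithUps n k upFromZero) ⟨
  + ∑ (pathsWithUps n k) (λ p → weight p * upFromZero p) / (n !) ∎
  where
  open ≡-Reasoning
  c cf S : ℕ
  c = length (pathsWithUps n k)
  cf = k ! * (n ∸ k) !
  S = ∑ (pathsWithUps n k) upFromZero
  instance
    n!≢0 : NonZero (n !)
    n!≢0 = n ℕP.!≢0
    c≢0 : NonZero c
    c≢0 = ℕP.m*n≢0⇒m≢0 c {{subst NonZero (sym (length-pathsWithUps k≤n)) (n ℕP.!≢0)}}
    1*c≢0 : NonZero (1 * c)
    1*c≢0 = ℕP.m*n≢0 1 c
  cross : S * n ! ≡ cf * S * (1 * c)
  cross = begin
    S * n !          ≡⟨ cong (S *_) (length-pathsWithUps k≤n) ⟨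
    S * (c * cf)     ≡⟨ regroup S c cf ⟩
    cf * S * (1 * c) ∎
    where
    regroup : ∀ s c f → s * (c * f) ≡ f * s * (1 * c)
    regroup = solve-∀

weightedUpFromZero : ℕ → ℕ
weightedUpFromZero n = ∑ (allPaths n) (λ p → weight p * upFromZero p)

expectedUpFromZero-weighted : ∀ n → expectedUpFromZero n ≡ (+ weightedUpFromZero n / suc n !) {{suc n ℕP.!≢0}}
expectedUpFromZero-weighted n = begin
  expectedUpFromZero n
    ≡⟨ cong avg (ListP.map-cong-local
         (All.map (λ { (s≤s k≤n) → avg-upFromZero-pathsTo k≤n }) (AllP.all-upTo (suc n)))) ⟩
  avg (map (λ k → + G k / (n !)) (upTo (suc n)))
    ≡⟨ avg-/ (upTo (suc n)) G (n !) ⟩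
  + ∑ (upTo (suc n)) G / (n ! * length (upTo (suc n)))
    ≡⟨ ℚP./-cong (cong +_ (sym partition))
                 (trans (cong (n ! *_) (ListP.length-upTo (suc n))) (ℕP.*-comm (n !) (suc n))) ⟩
  + weightedUpFromZero n / suc n ! ∎
  where
  open ≡-Reasoning
  instance
    n!≢0 : NonZero (n !)
    n!≢0 = n ℕP.!≢0
    [1+n]!≢0 : NonZero (suc n !)
    [1+n]!≢0 = suc n ℕP.!≢0
    n!*[1+n]≢0 : NonZero (n ! * length (upTo (suc n)))
    n!*[1+n]≢0 = ℕP.m*n≢0 (n !) (suc _)
  G : ℕ → ℕ
  G k = ∑ (pathsWithUps n k) (λ p → weight p * upFromZero p)
  partition : weightedUpFromZero n ≡ ∑ (upTo (suc n)) G
  partition = ∑-partition (suc n) ups (allPaths n) _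
    (All.map (λ {p} len → s≤s (subst (ups p ≤_) len (ℕP.m≤m+n (ups p) (downs p)))) (allPaths-length n))

-- Written as in upFromZeroFrom, so that the two agree definitionally.
atZero : ℤ → ℕ
atZero h = if ℤ.∣ h ∣ ≡ᵇ 0 then 1 else 0

atZero-* : ∀ h x → atZero h * x ≡ when (h ℤ.≟ + 0) x
atZero-* (+ zero)    x = ℕP.*-identityˡ x
atZero-* (+ suc _)   x = refl
atZero-* (-[1+ _ ])  x = refl

upFromZeroFrom-∷ʳ-false : ∀ h p → upFromZeroFrom h (p ++ [ false ]) ≡ upFromZeroFrom h p
upFromZeroFrom-∷ʳ-false h []          = refl
upFromZeroFrom-∷ʳ-false h (true ∷ p)  = cong (_+_ (atZero h)) (upFromZeroFrom-∷ʳ-false (h ℤ.+ + 1) p)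
upFromZeroFrom-∷ʳ-false h (false ∷ p) = upFromZeroFrom-∷ʳ-false (h ℤ.- + 1) p

upFromZeroFrom-∷ʳ-true : ∀ h p → upFromZeroFrom h (p ++ [ true ]) ≡ upFromZeroFrom h p + atZero (h ℤ.+ endHeight p)
upFromZeroFrom-∷ʳ-true h []          = trans (ℕP.+-identityʳ (atZero h)) (cong atZero (sym (ℤP.+-identityʳ h)))
upFromZeroFrom-∷ʳ-true h (true ∷ p)  = begin
  atZero h + upFromZeroFrom (h ℤ.+ + 1) (p ++ [ true ])
    ≡⟨ cong (_+_ (atZero h)) (upFromZeroFrom-∷ʳ-true (h ℤ.+ + 1) p) ⟩
  atZero h + (upFromZeroFrom (h ℤ.+ + 1) p + atZero (h ℤ.+ + 1 ℤ.+ endHeight p))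
    ≡⟨ ℕP.+-assoc (atZero h) _ _ ⟨
  atZero h + upFromZeroFrom (h ℤ.+ + 1) p + atZero (h ℤ.+ + 1 ℤ.+ endHeight p)
    ≡⟨ cong (λ h′ → atZero h + upFromZeroFrom (h ℤ.+ + 1) p + atZero h′) (xy∙z≈x∙zy h (+ 1) (endHeight p)) ⟩
  atZero h + upFromZeroFrom (h ℤ.+ + 1) p + atZero (h ℤ.+ (endHeight p ℤ.+ + 1)) ∎
  where open ≡-Reasoning
upFromZeroFrom-∷ʳ-true h (false ∷ p) = trans (upFromZeroFrom-∷ʳ-true (h ℤ.- + 1) p)
  (cong (λ h′ → upFromZeroFrom (h ℤ.- + 1) p + atZero h′) (xy∙z≈x∙zy h (ℤ.- + 1) (endHeight p)))

upFromZero-∷ʳ-true : ∀ p → upFromZero (p ++ [ true ]) ≡ upFromZero p + atZero (endHeight p)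
upFromZero-∷ʳ-true p = trans (upFromZeroFrom-∷ʳ-true (+ 0) p)
  (cong (λ h → upFromZero p + atZero h) (ℤP.+-identityˡ (endHeight p)))

returnWeight : ℕ → ℕ
returnWeight n = ∑ (allPaths n) (λ p → atZero (endHeight p) * (suc (ups p) * weight p))

weightedUpFromZero-suc : ∀ n → weightedUpFromZero (suc n) ≡ (2 + n) * weightedUpFromZero n + returnWeight n
weightedUpFromZero-suc n = begin
  weightedUpFromZero (suc n)
    ≡⟨ ∑-allPaths-snoc n (λ p → weight p * upFromZero p) ⟩
  ∑ (allPaths n) (λ p → weight (p ++ [ true ]) * upFromZero (p ++ [ true ])
                        + weight (p ++ [ false ]) * upFromZero (p ++ [ false ]))
    ≡⟨ ∑-allPaths-cong n extend ⟩
  ∑ (allPaths n) (λ p → (2 + n) * (weight p * upFromZero p) + atZero (endHeight p) * (suc (ups p) * weight p))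
    ≡⟨ ∑-+ (allPaths n) _ _ ⟩
  ∑ (allPaths n) (λ p → (2 + n) * (weight p * upFromZero p)) + returnWeight n
    ≡⟨ cong (_+ returnWeight n) (∑-*ˡ (allPaths n) (2 + n) _) ⟩
  (2 + n) * weightedUpFromZero n + returnWeight n ∎
  where
  open ≡-Reasoning
  regroup : ∀ u d w z e → (suc u * w) * (z + e) + (suc d * w) * z ≡ (2 + (u + d)) * (w * z) + e * (suc u * w)
  regroup = solve-∀
  extend : ∀ p → ups p + downs p ≡ n →
           weight (p ++ [ true ]) * upFromZero (p ++ [ true ]) + weight (p ++ [ false ]) * upFromZero (p ++ [ false ])
           ≡ (2 + n) * (weight p * upFromZero p) + atZero (endHeight p) * (suc (ups p) * weight p)
  extend p len rewrite weight-∷ʳ-true p | weight-∷ʳ-false p | upFromZero-∷ʳ-true p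
                     | upFromZeroFrom-∷ʳ-false (+ 0) p | sym len =
    regroup (ups p) (downs p) (weight p) (upFromZero p) (atZero (endHeight p))

endpoint-diagonal : ∀ m → endpoint (2 * m) m ≡ + 0
endpoint-diagonal m = trans (endpoint-⊖ (2 * m) m) (ℤP.n⊖n≡0 (2 * m))

endpoint≡0⇒2*k≡n : ∀ n k → endpoint n k ≡ + 0 → 2 * k ≡ n
endpoint≡0⇒2*k≡n n k eq = ℤP.+-injective (ℤP.i-j≡0⇒i≡j (+ (2 * k)) (+ n) eq)

returnWeight-even : ∀ m → returnWeight (2 * m) ≡ suc m * (2 * m) !
returnWeight-even m = begin
  returnWeight (2 * m)
    ≡⟨ ∑-allPaths-cong (2 * m) at-middle ⟩
  ∑ (allPaths (2 * m)) (λ p → when (ups p ℕ.≟ m) (suc (ups p) * weight p))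
    ≡⟨ ∑-pathsWithUps-scale (2 * m) m (suc m) (λ p _ u≡m → cong (λ u → suc u * weight p) u≡m) ⟩
  suc m * totalWeight (2 * m) m
    ≡⟨ cong (suc m *_) (totalWeight≡! (ℕP.m≤n*m m 2)) ⟩
  suc m * (2 * m) ! ∎
  where
  open ≡-Reasoning
  at-middle : ∀ p → ups p + downs p ≡ 2 * m →
              atZero (endHeight p) * (suc (ups p) * weight p) ≡ when (ups p ℕ.≟ m) (suc (ups p) * weight p)
  at-middle p len = trans (atZero-* (endHeight p) _) (when-cong (endHeight p ℤ.≟ + 0) (ups p ℕ.≟ m)
    (subst (λ D → (endHeight p ≡ D) ⇔ (ups p ≡ m)) (endpoint-diagonal m) (endHeight≡endpoint⇔ups≡ m p len)))

returnWeight-odd : ∀ m → returnWeight (suc (2 * m)) ≡ 0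
returnWeight-odd m = trans (∑-allPaths-cong (suc (2 * m)) off-axis) (∑-zero (allPaths (suc (2 * m))))
  where
  off-axis : ∀ p → ups p + downs p ≡ suc (2 * m) → atZero (endHeight p) * (suc (ups p) * weight p) ≡ 0
  off-axis p len = trans (atZero-* (endHeight p) _) (when-no (endHeight p ℤ.≟ + 0) λ h≡0 →
    ℕP.even≢odd (ups p) m (trans (endpoint≡0⇒2*k≡n _ (ups p) (trans (sym (endHeight-endpoint p)) h≡0)) len))

expectedUpFromZero-suc : ∀ n → expectedUpFromZero (suc n) ≡
  expectedUpFromZero n ℚ.+ (+ returnWeight n / suc (suc n) !) {{suc (suc n) ℕP.!≢0}}
expectedUpFromZero-suc n = begin
  expectedUpFromZero (suc n)
    ≡⟨ expectedUpFromZero-weighted (suc n) ⟩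
  + weightedUpFromZero (suc n) / suc (suc n) !
    ≡⟨ cong (λ t → + t / suc (suc n) !) (weightedUpFromZero-suc n) ⟩
  + (suc (suc n) * T + returnWeight n) / suc (suc n) !
    ≡⟨ /-distribʳ-+ (suc (suc n) * T) (returnWeight n) (suc (suc n) !) ⟩
  + (suc (suc n) * T) / suc (suc n) ! ℚ.+ + returnWeight n / suc (suc n) !
    ≡⟨ cong (ℚ._+ + returnWeight n / suc (suc n) !)
            (/-cross (suc (suc n) * T) (suc (suc n) !) T (suc n !) (regroup (suc (suc n)) T (suc n !))) ⟩
  + T / suc n ! ℚ.+ + returnWeight n / suc (suc n) !
    ≡⟨ cong (ℚ._+ + returnWeight n / suc (suc n) !) (expectedUpFromZero-weighted n) ⟨
  expectedUpFromZero n ℚ.+ + returnWeight n / suc (suc n) ! ∎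
  where
  open ≡-Reasoning
  T : ℕ
  T = weightedUpFromZero n
  instance
    [1+n]!≢0 : NonZero (suc n !)
    [1+n]!≢0 = suc n ℕP.!≢0
    [2+n]!≢0 : NonZero (suc (suc n) !)
    [2+n]!≢0 = suc (suc n) ℕP.!≢0
  regroup : ∀ m t f → m * t * f ≡ t * (m * f)
  regroup = solve-∀

-- The summand of Hodd: Hodd (suc m) is Hodd m ℚ.+ oddReciprocal (suc m) by definition.
oddReciprocal : ℕ → ℚ
oddReciprocal zero    = 0ℚ
oddReciprocal (suc m) = if suc m % 2 ≡ᵇ 1 then + 1 / suc m else 0ℚ

oddReciprocal-odd : ∀ m → oddReciprocal (suc (2 * m)) ≡ + 1 / suc (2 * m)
oddReciprocal-odd m = cong (λ r → if r ≡ᵇ 1 then + 1 / suc (2 * m) else 0ℚ)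
  (trans (cong (λ k → suc k % 2) (ℕP.*-comm 2 m)) ([m+kn]%n≡m%n 1 m 2))

oddReciprocal-even : ∀ m → oddReciprocal (suc (suc (2 * m))) ≡ 0ℚ
oddReciprocal-even m = cong (λ r → if r ≡ᵇ 1 then + 1 / suc (suc (2 * m)) else 0ℚ)
  (trans (cong (λ k → suc (suc k) % 2) (ℕP.*-comm 2 m)) ([m+kn]%n≡m%n 2 m 2))

data EvenOdd : ℕ → Set where
  even : ∀ m → EvenOdd (2 * m)
  odd  : ∀ m → EvenOdd (suc (2 * m))

evenOdd : ∀ n → EvenOdd n
evenOdd zero = even 0
evenOdd (suc n) with evenOdd n
... | even m = odd m
... | odd m  = subst EvenOdd (ℕP.+-suc (suc m) (m + 0)) (even (suc m))

returnRatio : ∀ n → (+ returnWeight n / suc (suc n) !) {{suc (suc n) ℕP.!≢0}} ≡ + 1 / 2 ℚ.* oddReciprocal (suc n)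
returnRatio n with evenOdd n
... | even m = begin
  + returnWeight (2 * m) / suc (suc (2 * m)) !
    ≡⟨ cong (λ r → + r / suc (suc (2 * m)) !) (returnWeight-even m) ⟩
  + (suc m * (2 * m) !) / suc (suc (2 * m)) !
    ≡⟨ /-cross (suc m * (2 * m) !) (suc (suc (2 * m)) !) (1 * 1) (2 * suc (2 * m)) (regroup m ((2 * m) !)) ⟩
  + (1 * 1) / (2 * suc (2 * m))
    ≡⟨ /-*-/ 1 2 1 (suc (2 * m)) ⟨
  + 1 / 2 ℚ.* (+ 1 / suc (2 * m))
    ≡⟨ cong (+ 1 / 2 ℚ.*_) (oddReciprocal-odd m) ⟨
  + 1 / 2 ℚ.* oddReciprocal (suc (2 * m)) ∎
  where
  open ≡-Reasoning
  instance
    [2+2m]!≢0 : NonZero (suc (suc (2 * m)) !)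
    [2+2m]!≢0 = suc (suc (2 * m)) ℕP.!≢0
  regroup : ∀ j f → suc j * f * (2 * suc (2 * j)) ≡ 1 * 1 * (suc (suc (2 * j)) * (suc (2 * j) * f))
  regroup = solve-∀
... | odd m = begin
  + returnWeight (suc (2 * m)) / suc (suc (suc (2 * m))) !
    ≡⟨ cong (λ r → + r / suc (suc (suc (2 * m))) !) (returnWeight-odd m) ⟩
  + 0 / suc (suc (suc (2 * m))) !
    ≡⟨ ℚP.0/n≡0 (suc (suc (suc (2 * m))) !) ⟩
  0ℚ
    ≡⟨ ℚP.*-zeroʳ (+ 1 / 2) ⟨
  + 1 / 2 ℚ.* 0ℚ
    ≡⟨ cong (+ 1 / 2 ℚ.*_) (oddReciprocal-even m) ⟨
  + 1 / 2 ℚ.* oddReciprocal (suc (suc (2 * m))) ∎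
  where
  open ≡-Reasoning
  instance
    [3+2m]!≢0 : NonZero (suc (suc (suc (2 * m))) !)
    [3+2m]!≢0 = suc (suc (suc (2 * m))) ℕP.!≢0

corollary6p2 : (n : ℕ) → expectedUpFromZero n ≡ ((+ 1) / 2) ℚ.* Hodd n
corollary6p2 zero    = refl
corollary6p2 (suc n) = begin
  expectedUpFromZero (suc n)
    ≡⟨ expectedUpFromZero-suc n ⟩
  expectedUpFromZero n ℚ.+ + returnWeight n / suc (suc n) !
    ≡⟨ cong₂ ℚ._+_ (corollary6p2 n) (returnRatio n) ⟩
  + 1 / 2 ℚ.* Hodd n ℚ.+ + 1 / 2 ℚ.* oddReciprocal (suc n)
    ≡⟨ ℚP.*-distribˡ-+ (+ 1 / 2) (Hodd n) (oddReciprocal (suc n)) ⟨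
  + 1 / 2 ℚ.* Hodd (suc n) ∎
  where
  open ≡-Reasoning
  instance
    [2+n]!≢0 : NonZero (suc (suc n) !)
    [2+n]!≢0 = suc (suc n) ℕP.!≢0
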